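{- Let $\mathcal{L}\in\{\mathtt{ME},\mathtt{ME}^\infty\}$. There is an effective translation $(\cdot)^{\ast}$ from $\mathcal{L}(A)$-sentences to $\mathtt{M}(A)$-sentences such that a sentence $\phi\in\mathcal{L}(A)$ is invariant under taking quotients if and only if $\phi\equiv\phi^{\ast}$.
   Context: Fix a finite set $A$ of monadic predicate symbols. A monadic model is $(D,V)$, $D$ a set (possibly empty), $V:A\to\wp(D)$. $\mathtt{ME}^\infty(A)$: $\varphi::=\top\mid\bot\mid a(x)\mid\neg a(x)\mid x\approx y\mid x\not\approx y\mid\varphi\vee\varphi\mid\varphi\wedge\varphi\mid\exists x.\varphi\mid\forall x.\varphi\mid\exists^\infty x.\varphi\mid\forall^\infty x.\varphi$; $\mathtt{ME}(A)$ omits $\exists^\infty,\forall^\infty$; $\mathtt{M}(A)$ additionally omits $\approx,\not\approx$. Standard semantics on nonempty models ($\exists^\infty$: infinitely many, $\forall^\infty$: all but finitely many); on the empty model $\exists,\exists^\infty$-sentences false, $\forall,\forall^\infty$-sentences true. $\equiv$: truth in the same models. A homomorphism $f:(D,V)\to(D',V')$ is a map with $d\in V(a)\iff f(d)\in V'(a)$ for all $a\in A$, $d\in D$; $\mathbb{D}'$ is a quotient of $\mathbb{D}$ if there is a surjective homomorphism $\mathbb{D}\to\mathbb{D}'$; $\phi$ is invariant under taking quotients if $\mathbb{D}\models\phi\iff\mathbb{D}'\models\phi$ whenever $\mathbb{D}'$ is a quotient of $\mathbb{D}$. -}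

module Defs where

open import Level using (0ℓ)
open import Data.Nat using (ℕ; zero; suc)
open import Data.Fin using (Fin; zero; suc)
open import Data.Empty using (⊥)
open import Data.Unit using (⊤)
open import Data.Product using (Σ; ∃; _×_; _,_)
open import Data.Sum using (_⊎_)
open import Data.List using (List)
open import Data.List.Membership.Propositional using (_∈_)
open import Relation.Nullary using (¬_)
open import Relation.Binary.PropositionalEquality using (_≡_; _≢_)
open import Function.Bundles using (_⇔_)

data Lang : Set where
  M ME MEinf : Lang

HasEq : Lang → Set
HasEq M     = ⊥
HasEq ME    = ⊤
HasEq MEinf = ⊤

HasInf : Lang → Set
HasInf M     = ⊥
HasInf ME    = ⊥
HasInf MEinf = ⊤

-- Formulas over the predicate symbols A = Fin k, with (de Bruijn)
-- free variables among Fin n.  Constructors not available in a given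
-- language require (impossible) evidence HasEq / HasInf.
data Formula (k : ℕ) (L : Lang) : ℕ → Set where
  ⊤'    : ∀ {n} → Formula k L n
  ⊥'    : ∀ {n} → Formula k L n
  atom  : ∀ {n} → Fin k → Fin n → Formula k L n
  natom : ∀ {n} → Fin k → Fin n → Formula k L n
  eq    : ∀ {n} → HasEq L → Fin n → Fin n → Formula k L n
  neq   : ∀ {n} → HasEq L → Fin n → Fin n → Formula k L n
  _∨'_  : ∀ {n} → Formula k L n → Formula k L n → Formula k L n
  _∧'_  : ∀ {n} → Formula k L n → Formula k L n → Formula k L n
  ∃'    : ∀ {n} → Formula k L (suc n) → Formula k L n
  ∀'    : ∀ {n} → Formula k L (suc n) → Formula k L n
  ∃∞    : ∀ {n} → HasInf L → Formula k L (suc n) → Formula k L n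
  ∀∞    : ∀ {n} → HasInf L → Formula k L (suc n) → Formula k L n

Sentence : ℕ → Lang → Set
Sentence k L = Formula k L 0

-- A monadic model (D, V), D possibly empty, V : A → ℘(D).
record Model (k : ℕ) : Set₁ where
  field
    D : Set
    V : Fin k → D → Set
open Model public

FinitelyMany : {D : Set} → (D → Set) → Set
FinitelyMany {D} P = Σ (List D) λ xs → ∀ d → P d → d ∈ xs

InfinitelyMany : {D : Set} → (D → Set) → Set
InfinitelyMany P = ¬ FinitelyMany P

AllButFinitelyMany : {D : Set} → (D → Set) → Set
AllButFinitelyMany P = FinitelyMany (λ d → ¬ P d)

extend : {D : Set} {n : ℕ} → (Fin n → D) → D → Fin (suc n) → D
extend ρ d zero    = d
extend ρ d (suc i) = ρ i

Sat : ∀ {k L n} (𝔻 : Model k) → (Fin n → D 𝔻) → Formula k L n → Set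
Sat 𝔻 ρ ⊤'           = ⊤
Sat 𝔻 ρ ⊥'           = ⊥
Sat 𝔻 ρ (atom a x)   = V 𝔻 a (ρ x)
Sat 𝔻 ρ (natom a x)  = ¬ V 𝔻 a (ρ x)
Sat 𝔻 ρ (eq _ x y)   = ρ x ≡ ρ y
Sat 𝔻 ρ (neq _ x y)  = ρ x ≢ ρ y
Sat 𝔻 ρ (φ ∨' ψ)     = Sat 𝔻 ρ φ ⊎ Sat 𝔻 ρ ψ
Sat 𝔻 ρ (φ ∧' ψ)     = Sat 𝔻 ρ φ × Sat 𝔻 ρ ψ
Sat 𝔻 ρ (∃' φ)       = Σ (D 𝔻) λ d → Sat 𝔻 (extend ρ d) φ
Sat 𝔻 ρ (∀' φ)       = (d : D 𝔻) → Sat 𝔻 (extend ρ d) φ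
Sat 𝔻 ρ (∃∞ _ φ)     = InfinitelyMany (λ d → Sat 𝔻 (extend ρ d) φ)
Sat 𝔻 ρ (∀∞ _ φ)     = AllButFinitelyMany (λ d → Sat 𝔻 (extend ρ d) φ)

noVars : {D : Set} → Fin 0 → D
noVars ()

_⊨_ : ∀ {k L} → Model k → Sentence k L → Set
𝔻 ⊨ φ = Sat 𝔻 noVars φ

_≡ₛ_ : ∀ {k L L'} → Sentence k L → Sentence k L' → Set₁
_≡ₛ_ {k} φ ψ = (𝔻 : Model k) → (𝔻 ⊨ φ) ⇔ (𝔻 ⊨ ψ)

IsHom : ∀ {k} (𝔻 𝔻' : Model k) → (D 𝔻 → D 𝔻') → Set
IsHom {k} 𝔻 𝔻' f = (a : Fin k) (d : D 𝔻) → V 𝔻 a d ⇔ V 𝔻' a (f d)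

Surj : {X Y : Set} → (X → Y) → Set
Surj {X} {Y} f = (y : Y) → Σ X λ x → f x ≡ y

QuotientInvariant : ∀ {k L} → Sentence k L → Set₁
QuotientInvariant {k} φ =
  (𝔻 𝔻' : Model k) (f : D 𝔻 → D 𝔻') → IsHom 𝔻 𝔻' f → Surj f →
  (𝔻 ⊨ φ) ⇔ (𝔻' ⊨ φ)

-- The translation φ* replaces x ≈ y by "x and y satisfy the same predicates", x ≉ y by its
-- dual, ∃^∞ by ⊥ and ∀^∞ by ⊤.  Sentences of M are invariant under surjective
-- homomorphisms, so φ ≡ φ* makes φ quotient invariant.  Conversely, every model maps
-- surjectively onto its model of realized types, which is finite and in which two
-- elements are equal exactly when they satisfy the same predicates; there φ and φ*
-- agree, and quotient invariance of φ and φ* transports this back to the original model.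
module Submission where

open import Defs
open import Level using (0ℓ)
open import Data.Nat using (ℕ)
open import Data.Product using (Σ)
open import Data.Sum using (_⊎_)
open import Relation.Binary.PropositionalEquality using (_≡_)
open import Function.Bundles using (_⇔_)
open import Axiom.ExcludedMiddle using (ExcludedMiddle)

open import Data.Nat using (zero; suc)
open import Data.Fin using (Fin; zero; suc)
open import Data.Fin.Properties using (¬∀⟶∃¬)
open import Data.Bool using (Bool; true; false; T)
open import Data.Bool.Properties using (T-irrelevant)
open import Data.Vec using (Vec; []; _∷_; lookup; tabulate)
open import Data.Vec.Properties using (lookup∘tabulate; tabulate∘lookup; tabulate-cong)
open import Data.List using (List; []; _∷_; [_]; cartesianProductWith)
open import Data.List.Membership.Propositional using (_∈_)
open import Data.List.Membership.Propositional.Properties using (∈-cartesianProductWith⁺)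
open import Data.List.Relation.Unary.Any using (here; there)
open import Data.Product using (_×_; _,_; proj₁; proj₂; ∃)
open import Data.Product.Function.NonDependent.Propositional using (_×-⇔_)
open import Data.Sum using (inj₁; inj₂)
open import Data.Sum.Function.Propositional using (_⊎-⇔_)
open import Data.Empty using (⊥-elim)
open import Data.Unit using (tt)
open import Relation.Nullary using (¬_; Dec; yes; no; contradiction)
open import Relation.Nullary.Decidable using (T?; toWitness; fromWitness; isYes; ¬?; _×-dec_; _⊎-dec_)
open import Relation.Binary.PropositionalEquality using (_≢_; _≗_; refl; sym; trans; cong; subst)
open import Function using (_∘_)
open import Function.Bundles using (mk⇔; Equivalence)
open import Function.Properties.Equivalence using (⇔-setoid)
open import Function.Construct.Identity using (⇔-id)
open import Function.Construct.Symmetry using (⇔-sym)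
open import Function.Construct.Composition using (_⇔-∘_)
open import Function.Related.TypeIsomorphisms using (¬-cong-⇔)

open Equivalence using (to; from)

∃-cong-⇔ : {X : Set} {P Q : X → Set} → (∀ x → P x ⇔ Q x) → Σ X P ⇔ Σ X Q
∃-cong-⇔ P⇔Q = mk⇔ (λ (x , p) → x , to (P⇔Q x) p) (λ (x , q) → x , from (P⇔Q x) q)

∀-cong-⇔ : {X : Set} {P Q : X → Set} → (∀ x → P x ⇔ Q x) → (∀ x → P x) ⇔ (∀ x → Q x)
∀-cong-⇔ P⇔Q = mk⇔ (λ p x → to (P⇔Q x) (p x)) (λ q x → from (P⇔Q x) (q x))

Agree Disagree : Set → Set → Set
Agree    P Q = (P × Q) ⊎ (¬ P × ¬ Q)
Disagree P Q = (P × ¬ Q) ⊎ (¬ P × Q)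

agree? : {P Q : Set} → Dec P → Dec Q → Dec (Agree P Q)
agree? P? Q? = (P? ×-dec Q?) ⊎-dec (¬? P? ×-dec ¬? Q?)

agree-refl : {P : Set} → Dec P → Agree P P
agree-refl (yes p) = inj₁ (p , p)
agree-refl (no ¬p) = inj₂ (¬p , ¬p)

agree⇒⇔ : {P Q : Set} → Agree P Q → P ⇔ Q
agree⇒⇔ (inj₁ (p , q))   = mk⇔ (λ _ → q) (λ _ → p)
agree⇒⇔ (inj₂ (¬p , ¬q)) = mk⇔ (⊥-elim ∘ ¬p) (⊥-elim ∘ ¬q)

disagree⇒¬agree : {P Q : Set} → Disagree P Q → ¬ Agree P Q
disagree⇒¬agree (inj₁ (p , ¬q)) (inj₁ (_ , q))  = ¬q q
disagree⇒¬agree (inj₁ (p , ¬q)) (inj₂ (¬p , _)) = ¬p p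
disagree⇒¬agree (inj₂ (¬p , q)) (inj₁ (p , _))  = ¬p p
disagree⇒¬agree (inj₂ (¬p , q)) (inj₂ (_ , ¬q)) = ¬q q

¬agree⇒disagree : {P Q : Set} → Dec P → Dec Q → ¬ Agree P Q → Disagree P Q
¬agree⇒disagree (yes p) (yes q) ¬agree = contradiction (inj₁ (p , q)) ¬agree
¬agree⇒disagree (yes p) (no ¬q) _      = inj₁ (p , ¬q)
¬agree⇒disagree (no ¬p) (yes q) _      = inj₂ (¬p , q)
¬agree⇒disagree (no ¬p) (no ¬q) ¬agree = contradiction (inj₂ (¬p , ¬q)) ¬agree

⋀ ⋁ : ∀ {k L n m} → (Fin m → Formula k L n) → Formula k L n
⋀ {m = zero}  φ = ⊤'
⋀ {m = suc m} φ = φ zero ∧' ⋀ (φ ∘ suc)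
⋁ {m = zero}  φ = ⊥'
⋁ {m = suc m} φ = φ zero ∨' ⋁ (φ ∘ suc)

module _ {k} (𝔻 : Model k) {n} (ρ : Fin n → D 𝔻) where

  Sat-⋀ : ∀ {L m} (φ : Fin m → Formula k L n) → Sat 𝔻 ρ (⋀ φ) ⇔ (∀ i → Sat 𝔻 ρ (φ i))
  Sat-⋀ {m = zero}  φ = mk⇔ (λ _ ()) _
  Sat-⋀ {m = suc m} φ = mk⇔
    (λ { (s₀ , s) zero → s₀ ; (s₀ , s) (suc i) → to (Sat-⋀ (φ ∘ suc)) s i })
    (λ s → s zero , from (Sat-⋀ (φ ∘ suc)) (s ∘ suc))

  Sat-⋁ : ∀ {L m} (φ : Fin m → Formula k L n) → Sat 𝔻 ρ (⋁ φ) ⇔ ∃ (λ i → Sat 𝔻 ρ (φ i))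
  Sat-⋁ {m = zero}  φ = mk⇔ (λ ()) (λ ())
  Sat-⋁ {m = suc m} φ = mk⇔
    (λ { (inj₁ s) → zero , s ; (inj₂ s) → let i , sᵢ = to (Sat-⋁ (φ ∘ suc)) s in suc i , sᵢ })
    (λ { (zero , s) → inj₁ s ; (suc i , s) → inj₂ (from (Sat-⋁ (φ ∘ suc)) (i , s)) })

agreeOn disagreeOn : ∀ {k L n} → Fin k → Fin n → Fin n → Formula k L n
agreeOn    a x y = (atom a x ∧' atom a y)  ∨' (natom a x ∧' natom a y)
disagreeOn a x y = (atom a x ∧' natom a y) ∨' (natom a x ∧' atom a y)

toMonadic : ∀ {k L n} → Formula k L n → Formula k M n
toMonadic ⊤'          = ⊤'
toMonadic ⊥'          = ⊥'
toMonadic (atom a x)  = atom a x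
toMonadic (natom a x) = natom a x
toMonadic (eq _ x y)  = ⋀ λ a → agreeOn a x y
toMonadic (neq _ x y) = ⋁ λ a → disagreeOn a x y
toMonadic (φ ∨' ψ)    = toMonadic φ ∨' toMonadic ψ
toMonadic (φ ∧' ψ)    = toMonadic φ ∧' toMonadic ψ
toMonadic (∃' φ)      = ∃' (toMonadic φ)
toMonadic (∀' φ)      = ∀' (toMonadic φ)
toMonadic (∃∞ _ φ)    = ⊥'
toMonadic (∀∞ _ φ)    = ⊤'

extend-≗ : {X Y : Set} {n : ℕ} (f : X → Y) {ρ : Fin n → X} {ρ′ : Fin n → Y} {d : X} {d′ : Y} →
  f ∘ ρ ≗ ρ′ → f d ≡ d′ → f ∘ extend ρ d ≗ extend ρ′ d′
extend-≗ f fρ≗ρ′ fd≡d′ zero    = fd≡d′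
extend-≗ f fρ≗ρ′ fd≡d′ (suc i) = fρ≗ρ′ i

module _ {k} {𝔻 𝔻′ : Model k} {f : D 𝔻 → D 𝔻′} (hom : IsHom 𝔻 𝔻′ f) (surj : Surj f) where

  Sat-surjectiveHom : ∀ {n} (φ : Formula k M n) {ρ ρ′} → f ∘ ρ ≗ ρ′ → Sat 𝔻 ρ φ ⇔ Sat 𝔻′ ρ′ φ
  Sat-surjectiveHom ⊤'          _      = ⇔-id _
  Sat-surjectiveHom ⊥'          _      = ⇔-id _
  Sat-surjectiveHom (atom a x) {ρ} fρ≗ρ′ = subst (λ d′ → _ ⇔ V 𝔻′ a d′) (fρ≗ρ′ x) (hom a (ρ x))
  Sat-surjectiveHom (natom a x) fρ≗ρ′  = ¬-cong-⇔ (Sat-surjectiveHom (atom a x) fρ≗ρ′)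
  Sat-surjectiveHom (φ ∨' ψ)    fρ≗ρ′  = Sat-surjectiveHom φ fρ≗ρ′ ⊎-⇔ Sat-surjectiveHom ψ fρ≗ρ′
  Sat-surjectiveHom (φ ∧' ψ)    fρ≗ρ′  = Sat-surjectiveHom φ fρ≗ρ′ ×-⇔ Sat-surjectiveHom ψ fρ≗ρ′
  Sat-surjectiveHom (∃' φ)      fρ≗ρ′  = mk⇔
    (λ (d , s) → f d , to (Sat-surjectiveHom φ (extend-≗ f fρ≗ρ′ refl)) s)
    (λ (d′ , s) → let d , fd≡d′ = surj d′ in d , from (Sat-surjectiveHom φ (extend-≗ f fρ≗ρ′ fd≡d′)) s)
  Sat-surjectiveHom (∀' φ)      fρ≗ρ′  = mk⇔
    (λ s d′ → let d , fd≡d′ = surj d′ in to (Sat-surjectiveHom φ (extend-≗ f fρ≗ρ′ fd≡d′)) (s d))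
    (λ s d → from (Sat-surjectiveHom φ (extend-≗ f fρ≗ρ′ refl)) (s (f d)))

quotientInvariant-M : ∀ {k} (ψ : Sentence k M) → QuotientInvariant ψ
quotientInvariant-M ψ 𝔻 𝔻′ f hom surj = Sat-surjectiveHom hom surj ψ (λ ())

≡ₛ-monadic⇒quotientInvariant : ∀ {k L} (φ : Sentence k L) (ψ : Sentence k M) →
  φ ≡ₛ ψ → QuotientInvariant φ
≡ₛ-monadic⇒quotientInvariant φ ψ φ≡ₛψ 𝔻 𝔻′ f hom surj =
  ⇔-sym (φ≡ₛψ 𝔻′) ⇔-∘ (quotientInvariant-M ψ 𝔻 𝔻′ f hom surj ⇔-∘ φ≡ₛψ 𝔻)

Finite : Set → Set
Finite X = Σ (List X) λ xs → ∀ x → x ∈ xs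

Separated : ∀ {k} → Model k → Set
Separated {k} 𝔻 = (d e : D 𝔻) → (∀ a → V 𝔻 a d ⇔ V 𝔻 a e) → d ≡ e

module _ {k} (𝔻 : Model k) (V? : ∀ a d → Dec (V 𝔻 a d))
         (separated : Separated 𝔻) (finite : Finite (D 𝔻)) where

  ≡⇔agree : (d e : D 𝔻) → d ≡ e ⇔ (∀ a → Agree (V 𝔻 a d) (V 𝔻 a e))
  ≡⇔agree d e = mk⇔
    (λ { refl a → agree-refl (V? a d) })
    (λ agree → separated d e (agree⇒⇔ ∘ agree))

  ≢⇔disagree : (d e : D 𝔻) → d ≢ e ⇔ ∃ (λ a → Disagree (V 𝔻 a d) (V 𝔻 a e))
  ≢⇔disagree d e = mk⇔
    (λ d≢e → let a , ¬agree = ¬∀⟶∃¬ k _ (λ a → agree? (V? a d) (V? a e)) (d≢e ∘ from (≡⇔agree d e))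
             in a , ¬agree⇒disagree (V? a d) (V? a e) ¬agree)
    (λ (a , disagree) d≡e → disagree⇒¬agree disagree (to (≡⇔agree d e) d≡e a))

  finitelyMany : (P : D 𝔻 → Set) → FinitelyMany P
  finitelyMany P = proj₁ finite , λ d _ → proj₂ finite d

  Sat-toMonadic : ∀ {L n} (φ : Formula k L n) (ρ : Fin n → D 𝔻) → Sat 𝔻 ρ φ ⇔ Sat 𝔻 ρ (toMonadic φ)
  Sat-toMonadic ⊤'          ρ = ⇔-id _
  Sat-toMonadic ⊥'          ρ = ⇔-id _
  Sat-toMonadic (atom a x)  ρ = ⇔-id _
  Sat-toMonadic (natom a x) ρ = ⇔-id _
  Sat-toMonadic (eq _ x y)  ρ = ⇔-sym (Sat-⋀ 𝔻 ρ _) ⇔-∘ ≡⇔agree (ρ x) (ρ y)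
  Sat-toMonadic (neq _ x y) ρ = ⇔-sym (Sat-⋁ 𝔻 ρ _) ⇔-∘ ≢⇔disagree (ρ x) (ρ y)
  Sat-toMonadic (φ ∨' ψ)    ρ = Sat-toMonadic φ ρ ⊎-⇔ Sat-toMonadic ψ ρ
  Sat-toMonadic (φ ∧' ψ)    ρ = Sat-toMonadic φ ρ ×-⇔ Sat-toMonadic ψ ρ
  Sat-toMonadic (∃' φ)      ρ = ∃-cong-⇔ λ d → Sat-toMonadic φ (extend ρ d)
  Sat-toMonadic (∀' φ)      ρ = ∀-cong-⇔ λ d → Sat-toMonadic φ (extend ρ d)
  Sat-toMonadic (∃∞ _ φ)    ρ = mk⇔ (λ infinite → infinite (finitelyMany _)) ⊥-elim
  Sat-toMonadic (∀∞ _ φ)    ρ = mk⇔ _ (λ _ → finitelyMany _)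

T-⇔⇒≡ : {b c : Bool} → T b ⇔ T c → b ≡ c
T-⇔⇒≡ {false} {false} _   = refl
T-⇔⇒≡ {false} {true}  b⇔c = ⊥-elim (from b⇔c tt)
T-⇔⇒≡ {true}  {false} b⇔c = ⊥-elim (to b⇔c tt)
T-⇔⇒≡ {true}  {true}  _   = refl

lookup-injective : ∀ {m} {A : Set} {u v : Vec A m} → lookup u ≗ lookup v → u ≡ v
lookup-injective {u = u} {v} u≗v = trans (sym (tabulate∘lookup u)) (trans (tabulate-cong u≗v) (tabulate∘lookup v))

Σ-T-≡ : {A : Set} {R : A → Bool} {x y : A} {p : T (R x)} {q : T (R y)} →
  x ≡ y → _≡_ {A = Σ A (T ∘ R)} (x , p) (y , q)
Σ-T-≡ {x = x} refl = cong (x ,_) (T-irrelevant _ _)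

finite-Bool : Finite Bool
finite-Bool = true ∷ false ∷ [] , λ { true → here refl ; false → there (here refl) }

finite-Vec : {A : Set} → Finite A → ∀ m → Finite (Vec A m)
finite-Vec (xs , x∈xs) zero    = [ [] ] , λ { [] → here refl }
finite-Vec (xs , x∈xs) (suc m) =
  let vs , v∈vs = finite-Vec (xs , x∈xs) m
  in cartesianProductWith _∷_ xs vs , λ { (x ∷ v) → ∈-cartesianProductWith⁺ _∷_ (x∈xs x) (v∈vs v) }

module _ {A : Set} (R : A → Bool) where

  restrict : List A → List (Σ A (T ∘ R))
  restrict [] = []
  restrict (x ∷ xs) with T? (R x)
  ... | yes p = (x , p) ∷ restrict xs
  ... | no _  = restrict xs

  ∈-restrict : ∀ {x xs} → x ∈ xs → (p : T (R x)) → (x , p) ∈ restrict xs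
  ∈-restrict {xs = y ∷ ys} (here refl) p with T? (R y)
  ... | yes _ = here (Σ-T-≡ refl)
  ... | no ¬p = contradiction p ¬p
  ∈-restrict {xs = y ∷ ys} (there x∈ys) p with T? (R y)
  ... | yes _ = there (∈-restrict x∈ys p)
  ... | no _  = ∈-restrict x∈ys p

  finite-Σ-T : Finite A → Finite (Σ A (T ∘ R))
  finite-Σ-T (xs , x∈xs) = restrict xs , λ (x , p) → ∈-restrict (x∈xs x) p

module TypeModel (em : ExcludedMiddle 0ℓ) {k} (𝔻 : Model k) where

  type : D 𝔻 → Vec Bool k
  type d = tabulate λ a → isYes (em {V 𝔻 a d})

  Realized : Vec Bool k → Set
  Realized t = ∃ λ d → type d ≡ t

  realized : Vec Bool k → Bool
  realized t = isYes (em {Realized t})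

  -- Realization is recorded as a boolean so that the elements of a type are unique.
  typeModel : Model k
  typeModel = record { D = Σ (Vec Bool k) (T ∘ realized) ; V = λ a u → T (lookup (proj₁ u) a) }

  toType : D 𝔻 → D typeModel
  toType d = type d , fromWitness (d , refl)

  toType-hom : IsHom 𝔻 typeModel toType
  toType-hom a d = subst (λ b → V 𝔻 a d ⇔ T b) (sym (lookup∘tabulate _ a)) (mk⇔ fromWitness toWitness)

  toType-surj : Surj toType
  toType-surj (t , r) = let d , type-d≡t = toWitness r in d , Σ-T-≡ type-d≡t

  typeModel-V? : ∀ a u → Dec (V typeModel a u)
  typeModel-V? a u = T? (lookup (proj₁ u) a)

  typeModel-separated : Separated typeModel
  typeModel-separated u v u⇔v = Σ-T-≡ (lookup-injective (T-⇔⇒≡ ∘ u⇔v))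

  typeModel-finite : Finite (D typeModel)
  typeModel-finite = finite-Σ-T realized (finite-Vec finite-Bool k)

quotientInvariant⇒≡ₛ-toMonadic : ExcludedMiddle 0ℓ → ∀ {k L} (φ : Sentence k L) →
  QuotientInvariant φ → φ ≡ₛ toMonadic φ
quotientInvariant⇒≡ₛ-toMonadic em φ inv 𝔻 = begin
  𝔻 ⊨ φ                      ≈⟨ inv 𝔻 typeModel toType toType-hom toType-surj ⟩
  typeModel ⊨ φ              ≈⟨ Sat-toMonadic typeModel typeModel-V? typeModel-separated typeModel-finite φ noVars ⟩
  typeModel ⊨ toMonadic φ    ≈⟨ quotientInvariant-M (toMonadic φ) 𝔻 typeModel toType toType-hom toType-surj ⟨
  𝔻 ⊨ toMonadic φ            ∎
  where
    open TypeModel em 𝔻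
    open import Relation.Binary.Reasoning.Setoid (⇔-setoid 0ℓ)

proposition6p13 : (k : ℕ) (L : Lang) → L ≡ ME ⊎ L ≡ MEinf →
    Σ (Sentence k L → Sentence k M) λ tr →
      ExcludedMiddle 0ℓ →
      (φ : Sentence k L) → QuotientInvariant φ ⇔ (φ ≡ₛ tr φ)
-- The translation is correct for every language.
proposition6p13 k L _ = toMonadic , λ em φ → mk⇔
  (quotientInvariant⇒≡ₛ-toMonadic em φ)
  (≡ₛ-monadic⇒quotientInvariant φ (toMonadic φ))
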